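{- Let $L=(X,\le)$ be a finite upper locally distributive lattice. If the system $\Omega$ has a solution in non-negative integers, then $L\in L(ASM)$.
   Context: Lattice notions: $\mathbf{0}$ least element; $x\prec y$ means $y$ covers $x$; $M$ is the set of meet-irreducibles (elements with exactly one upper cover), $M_x=\{m\in M:x\le m\}$; $L$ is upper locally distributive if $[x,x^{+}]$ is Boolean for each $x\ne\mathbf{1}$ ($x^{+}$ the join of the upper covers of $x$); then for each cover $x\prec y$, $M_x\setminus M_y$ has exactly one element $\mathfrak{m}(x,y)$. For $m\in M$, $\mathfrak{U}_m$ is the set of minimal elements of $\{x:\exists y,\ x\prec y,\ \mathfrak{m}(x,y)=m\}$ and $\mathfrak{L}_m$ the set of maximal elements of $X\setminus\bigcup_{a\in\mathfrak{U}_m}\{x:a\le x\}$. $\mathfrak{E}(m)$: if $\mathfrak{U}_m=\{\mathbf{0}\}$ it is $w_m\ge1$; otherwise it consists of $\sum_{x\in M\setminus M_a}e_{x,m}<w_m$ for $a\in\mathfrak{L}_m$ and $w_m\le\sum_{x\in M\setminus M_a}e_{x,m}$ for $a\in\mathfrak{U}_m$ (variables $w_m$, $e_{x,m}$ for $x\in\bigcup_{a\in\mathfrak{U}_m\cup\mathfrak{L}_m}(M\setminus M_a)$). With $U$ the set of all variables of all $\mathfrak{E}(m)$, $\Omega$ is $\bigcup_{m\in M}\mathfrak{E}(m)$ together with $e_{m_1,m_2}=e_{m_2,m_1}$ whenever both variables lie in $U$. Chip Firing Games: $G$ a finite directed multigraph, $E(u,v)$ the number of edges from $u$ to $v$; a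 sink is a vertex all of whose outgoing edges are loops; configurations are maps $V(G)\to\mathbb{N}$; a non-sink $v$ is firable in $c$ if $c(v)\ge deg^{+}(v)$, and firing moves one chip from $v$ along each outgoing edge. $CFG(G,\mathcal{O})$ is the set of configurations reachable from $\mathcal{O}$ ordered by reachability; with no infinite firing sequence it is a lattice, and lattices isomorphic to it are generated by the game. An ASM is such a game with $G$ connected, exactly one sink $s$, and $E(v_1,v_2)=E(v_2,v_1)$ for distinct $v_1,v_2\ne s$; $L(ASM)$ is the class of lattices generated by ASMs. -}

module Defs where

open import Data.Bool using (Bool; true; false; _∧_; _∨_; not; T; if_then_else_)
open import Data.Nat using (ℕ; zero; suc; _+_; _≤_; _<_; _≡ᵇ_)
open import Data.Fin using (Fin)
import Data.Fin as F
open import Data.List using (List; allFin; filterᵇ; map; length)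
open import Data.Bool.ListAction using (any; all)
open import Data.Nat.ListAction using (sum)
open import Data.Product using (Σ; ∃; ∃-syntax; _×_; _,_)
open import Data.Sum using (_⊎_)
open import Data.Empty using (⊥)
open import Relation.Nullary using (¬_)
open import Relation.Nullary.Decidable using (⌊_⌋)
open import Relation.Binary.PropositionalEquality using (_≡_; _≢_)
open import Relation.Binary.Construct.Closure.ReflexiveTransitive using (Star)

record FinLattice : Set where
  field
    n      : ℕ
    le     : Fin n → Fin n → Bool
    refl   : ∀ x → T (le x x)
    antisym : ∀ x y → T (le x y) → T (le y x) → x ≡ y
    trans  : ∀ x y z → T (le x y) → T (le y z) → T (le x z)
    join   : Fin n → Fin n → Fin n
    join-ub₁ : ∀ x y → T (le x (join x y))
    join-ub₂ : ∀ x y → T (le y (join x y))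
    join-least : ∀ x y z → T (le x z) → T (le y z) → T (le (join x y) z)
    meet   : Fin n → Fin n → Fin n
    meet-lb₁ : ∀ x y → T (le (meet x y) x)
    meet-lb₂ : ∀ x y → T (le (meet x y) y)
    meet-greatest : ∀ x y z → T (le z x) → T (le z y) → T (le z (meet x y))
    bot    : Fin n
    bot-least : ∀ x → T (le bot x)

module LatticeNotions (L : FinLattice) where
  open FinLattice L

  X : List (Fin n)
  X = allFin n

  eqᵇ : Fin n → Fin n → Bool
  eqᵇ x y = ⌊ x F.≟ y ⌋

  lt : Fin n → Fin n → Bool
  lt x y = le x y ∧ not (eqᵇ x y)

  cover : Fin n → Fin n → Bool
  cover x y = lt x y ∧ not (any (λ z → lt x z ∧ lt z y) X)

  isM : Fin n → Bool
  isM m = length (filterᵇ (cover m) X) ≡ᵇ 1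

  IsTop : Fin n → Set
  IsTop t = ∀ y → T (le y t)

  IsJoinOfUpperCovers : Fin n → Fin n → Set
  IsJoinOfUpperCovers x p =
    (∀ y → T (cover x y) → T (le y p)) ×
    (∀ q → (∀ y → T (cover x y) → T (le y q)) → T (le p q))

  InInterval : Fin n → Fin n → Fin n → Set
  InInterval a b u = T (le a u) × T (le u b)

  BooleanInterval : Fin n → Fin n → Set
  BooleanInterval a b =
    (∀ u v w → InInterval a b u → InInterval a b v → InInterval a b w →
       meet u (join v w) ≡ join (meet u v) (meet u w)) ×
    (∀ u → InInterval a b u →
       ∃[ v ] (InInterval a b v × meet u v ≡ a × join u v ≡ b))

  UpperLocallyDistributive : Set
  UpperLocallyDistributive =
    ∀ x → ¬ IsTop x → ∀ p → IsJoinOfUpperCovers x p → BooleanInterval x p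

  -- 𝔪(x,y) = m  (for a cover x ≺ y):  m ∈ M_x ∖ M_y
  -- (in an upper locally distributive lattice M_x ∖ M_y is a singleton)
  labelledBy : Fin n → Fin n → Fin n → Bool
  labelledBy m x y = cover x y ∧ isM m ∧ le x m ∧ not (le y m)

  startsLabel : Fin n → Fin n → Bool
  startsLabel m x = any (labelledBy m x) X

  inU : Fin n → Fin n → Bool
  inU m x = startsLabel m x ∧ not (any (λ z → lt z x ∧ startsLabel m z) X)

  outsideUp : Fin n → Fin n → Bool
  outsideUp m x = not (any (λ a → inU m a ∧ le a x) X)

  inL : Fin n → Fin n → Bool
  inL m x = outsideUp m x ∧ not (any (λ z → lt x z ∧ outsideUp m z) X)

  UisBot : Fin n → Bool
  UisBot m = all (λ x → (inU m x ∧ eqᵇ x bot) ∨ (not (inU m x) ∧ not (eqᵇ x bot))) X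

  sumE : (Fin n → Fin n → ℕ) → Fin n → Fin n → ℕ
  sumE e m a = sum (map (λ x → e x m) (filterᵇ (λ x → isM x ∧ not (le a x)) X))

  SatE : (Fin n → ℕ) → (Fin n → Fin n → ℕ) → Fin n → Set
  SatE w e m = if UisBot m
    then 1 ≤ w m
    else ((∀ a → T (inL m a) → sumE e m a < w m) ×
          (∀ a → T (inU m a) → w m ≤ sumE e m a))

  -- the variable e_{x,m} occurs in 𝔈(m') for some m' (i.e. lies in U)
  eVarInU : Fin n → Fin n → Bool
  eVarInU x m = isM m ∧ not (UisBot m) ∧ isM x ∧
    any (λ a → (inU m a ∨ inL m a) ∧ not (le a x)) X

  -- Ω has a solution in non-negative integers.  (Values assigned to
  -- symbols that are not variables of Ω are irrelevant.)
  OmegaSolvable : Set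
  OmegaSolvable =
    Σ (Fin n → ℕ) λ w → Σ (Fin n → Fin n → ℕ) λ e →
      (∀ m → T (isM m) → SatE w e m) ×
      (∀ m₁ m₂ → T (eVarInU m₁ m₂) → T (eVarInU m₂ m₁) → e m₁ m₂ ≡ e m₂ m₁)

-- Chip firing games on a finite directed multigraph with vertices Fin k;
-- E u v = number of edges from u to v.

Multigraph : ℕ → Set
Multigraph k = Fin k → Fin k → ℕ

Config : ℕ → Set
Config k = Fin k → ℕ

module CFG {k : ℕ} (E : Multigraph k) where

  outdeg : Fin k → ℕ
  outdeg v = sum (map (E v) (allFin k))

  IsSink : Fin k → Set
  IsSink s = ∀ u → u ≢ s → E s u ≡ 0

  -- c' is obtained from c by firing some firable non-sink vertex v:
  -- c'(u) = c(u) + E(v,u) - [u = v]·deg⁺(v)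
  Fire : Config k → Config k → Set
  Fire c c' = ∃[ v ] (¬ IsSink v × outdeg v ≤ c v ×
    (∀ u → c' u + (if ⌊ u F.≟ v ⌋ then outdeg v else 0) ≡ c u + E v u))

  Reach : Config k → Config k → Set
  Reach = Star Fire

  NoInfiniteFiring : Config k → Set
  NoInfiniteFiring O =
    ¬ (Σ (ℕ → Config k) λ f → (∀ u → f 0 u ≡ O u) × (∀ i → Fire (f i) (f (suc i))))

  -- L is isomorphic (as an ordered set, hence as a lattice) to CFG(G,O)
  Generates : Config k → FinLattice → Set
  Generates O L =
    NoInfiniteFiring O ×
    Σ (Fin (FinLattice.n L) → Config k) λ φ →
      (∀ x → Reach O (φ x)) ×
      (∀ c → Reach O c → ∃[ x ] (∀ u → φ x u ≡ c u)) ×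
      (∀ x y → (T (FinLattice.le L x y) → Reach (φ x) (φ y)) ×
               (Reach (φ x) (φ y) → T (FinLattice.le L x y)))

record ASM : Set where
  field
    k : ℕ
    E : Multigraph k
    O : Config k
  open CFG E
  field
    connected : ∀ u v → Star (λ a b → (0 < E a b) ⊎ (0 < E b a)) u v
    sink : Fin k
    sink-isSink : IsSink sink
    sink-unique : ∀ v → IsSink v → v ≡ sink
    symmetric : ∀ v₁ v₂ → v₁ ≢ v₂ → v₁ ≢ sink → v₂ ≢ sink → E v₁ v₂ ≡ E v₂ v₁

InLASM : FinLattice → Set
InLASM L = Σ ASM λ A → CFG.Generates (ASM.E A) (ASM.O A) L

module Submission where

-- The sandpile has a sink and a vertex per element of L, with e_{x,m} edges
-- between x and m (e read symmetrically) and 2·big edges to the sink.  The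
-- element y is encoded by the configuration φ y in which exactly the
-- vertices of M ∖ M_y have fired, each m starting from deg m (or deg m − w_m
-- when 𝔘_m ≠ {𝟎}).  The
-- 𝔘-inequalities of Ω then make m firable at φ y iff y has an upper cover
-- labelled m (the 𝔏-inequalities rule out the rest), firing it yields φ of
-- that cover, and φ is injective; so firing from φ 𝟎 mirrors the order of L.

open import Defs
import Algebra.Properties.CommutativeMonoid.Sum as FinSum
open import Data.Bool using (Bool; true; false; _∧_; _∨_; not; T; if_then_else_)
open import Data.Bool.ListAction using (any; all)
open import Data.Empty using (⊥; ⊥-elim)
open import Data.Fin using (Fin; zero; suc)
import Data.Fin as F
import Data.Fin.Properties as FinP
open import Data.List using (List; []; _∷_; allFin; filterᵇ; map; length; foldr; tabulate)
open import Data.List.Properties using (map-tabulate)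
open import Data.List.Membership.Propositional using (_∈_; lose)
open import Data.List.Membership.Propositional.Properties using (∈-allFin)
open import Data.List.Relation.Unary.Any using (here; there; satisfied)
open import Data.List.Relation.Unary.Any.Properties using (any⁺; any⁻)
import Data.List.Relation.Unary.All as All
open import Data.List.Relation.Unary.All.Properties using (all⁺)
open import Data.Nat using (ℕ; zero; suc; _+_; _∸_; _≤_; _<_; _≡ᵇ_; z≤n; s≤s)
open import Data.Nat.Induction using (<-wellFounded)
open import Data.Nat.ListAction using (sum)
open import Data.Nat.Properties
open import Data.Product using (∃; _×_; _,_; proj₁; proj₂)
open import Data.Sum using (_⊎_; inj₁; inj₂)
open import Data.Unit using (tt)
open import Function using (case_of_)
open import Induction.WellFounded using (Acc; acc)
open import Relation.Binary.Construct.Closure.ReflexiveTransitive using (Star; ε; _◅_; _◅◅_)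
open import Relation.Binary.PropositionalEquality using (_≡_; _≢_; refl; sym; trans; cong; cong₂; subst; module ≡-Reasoning)
open import Relation.Nullary using (¬_; yes; no; Dec)
open import Relation.Nullary.Decidable using (⌊_⌋; T?; toWitness; fromWitness; decidable-stable)

open FinSum +-0-commutativeMonoid using (sum-cong-≗; ∑-distrib-+) renaming (sum to ∑)

T-∧-intro : ∀ {a b} → T a → T b → T (a ∧ b)
T-∧-intro {true} {true} _ _ = tt

T-∧₁ : ∀ {a b} → T (a ∧ b) → T a
T-∧₁ {true} _ = tt

T-∧₂ : ∀ {a b} → T (a ∧ b) → T b
T-∧₂ {true} p = p

T-not-intro : ∀ {a} → ¬ T a → T (not a)
T-not-intro {false} _ = tt
T-not-intro {true} f = f tt

T-not-elim : ∀ {a} → T (not a) → ¬ T a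
T-not-elim {false} _ ()
T-not-elim {true} ()

T-not-not : ∀ {a} → ¬ T (not a) → T a
T-not-not {true} _ = tt
T-not-not {false} f = f tt

T-∨-elim : ∀ {a b} → T (a ∨ b) → T a ⊎ T b
T-∨-elim {true} _ = inj₁ tt
T-∨-elim {false} p = inj₂ p

T-∨₁ : ∀ {a b} → T a → T (a ∨ b)
T-∨₁ {true} _ = tt

T-∨₂ : ∀ {a b} → T b → T (a ∨ b)
T-∨₂ {true} _ = tt
T-∨₂ {false} p = p

T⇒≡true : ∀ {a} → T a → a ≡ true
T⇒≡true {true} _ = refl

¬T⇒≡false : ∀ {a} → ¬ T a → a ≡ false
¬T⇒≡false {false} _ = refl
¬T⇒≡false {true} f = ⊥-elim (f tt)

if-true : ∀ {A : Set} {b : Bool} {x y : A} → T b → (if b then x else y) ≡ x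
if-true {b = true} _ = refl

if-false : ∀ {A : Set} {b : Bool} {x y : A} → ¬ T b → (if b then x else y) ≡ y
if-false {b = b} nb rewrite ¬T⇒≡false nb = refl

module _ {n : ℕ} (p : Fin n → Bool) where

  any-intro : ∀ x → T (p x) → T (any p (allFin n))
  any-intro x px = any⁺ p (lose (∈-allFin x) px)

  any-witness : T (any p (allFin n)) → ∃ λ x → T (p x)
  any-witness h = satisfied (any⁻ p (allFin n) h)

  none-elim : T (not (any p (allFin n))) → ∀ x → ¬ T (p x)
  none-elim h x px = T-not-elim h (any-intro x px)

  none-intro : (∀ x → ¬ T (p x)) → T (not (any p (allFin n)))
  none-intro f = T-not-intro (λ h → let (x , px) = any-witness h in f x px)

  all-elim : T (all p (allFin n)) → ∀ x → T (p x)
  all-elim h x = All.lookup (all⁺ p (allFin n) h) (∈-allFin x)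

∑-mono : ∀ {n} (f g : Fin n → ℕ) → (∀ i → f i ≤ g i) → ∑ f ≤ ∑ g
∑-mono {zero} f g h = z≤n
∑-mono {suc n} f g h = +-mono-≤ (h zero) (∑-mono (λ i → f (suc i)) (λ i → g (suc i)) (λ i → h (suc i)))

∑-mono-< : ∀ {n} (f g : Fin n → ℕ) → (∀ i → f i ≤ g i) → ∀ j → f j < g j → ∑ f < ∑ g
∑-mono-< {suc n} f g h zero lt = +-mono-<-≤ lt (∑-mono (λ i → f (suc i)) (λ i → g (suc i)) (λ i → h (suc i)))
∑-mono-< {suc n} f g h (suc j) lt = +-mono-≤-< (h zero) (∑-mono-< (λ i → f (suc i)) (λ i → g (suc i)) (λ i → h (suc i)) j lt)

term≤∑ : ∀ {n} (f : Fin n → ℕ) j → f j ≤ ∑ f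
term≤∑ {suc n} f zero = m≤m+n _ _
term≤∑ {suc n} f (suc j) = ≤-trans (term≤∑ (λ i → f (suc i)) j) (m≤n+m _ (f zero))

∑-zero : ∀ {n} (f : Fin n → ℕ) → (∀ i → f i ≡ 0) → ∑ f ≡ 0
∑-zero {zero} f h = refl
∑-zero {suc n} f h rewrite h zero = ∑-zero (λ i → f (suc i)) (λ i → h (suc i))

∑-single : ∀ {n} (f : Fin n → ℕ) j → (∀ i → i ≢ j → f i ≡ 0) → ∑ f ≡ f j
∑-single {suc n} f zero h = trans (cong (f zero +_) (∑-zero (λ i → f (suc i)) (λ i → h (suc i) (λ ())))) (+-identityʳ _)
∑-single {suc n} f (suc j) h rewrite h zero (λ ()) =
  ∑-single (λ i → f (suc i)) j (λ i i≢j → h (suc i) (λ e → i≢j (FinP.suc-injective e)))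

∑-count : ∀ n → ∑ {n} (λ _ → 1) ≡ n
∑-count zero = refl
∑-count (suc n) = cong suc (∑-count n)

∑-two : ∀ {n} (f : Fin n → ℕ) i j → i ≢ j → 1 ≤ f i → 1 ≤ f j → 2 ≤ ∑ f
∑-two {suc n} f zero zero i≢j _ _ = ⊥-elim (i≢j refl)
∑-two {suc n} f zero (suc j) _ fi fj = +-mono-≤ fi (≤-trans fj (term≤∑ (λ k → f (suc k)) j))
∑-two {suc n} f (suc i) zero _ fi fj = +-mono-≤ fj (≤-trans fi (term≤∑ (λ k → f (suc k)) i))
∑-two {suc n} f (suc i) (suc j) i≢j fi fj =
  ≤-trans (∑-two (λ k → f (suc k)) i j (λ e → i≢j (cong suc e)) fi fj) (m≤n+m _ (f zero))

sum-allFin : ∀ {n} (f : Fin n → ℕ) → sum (map f (allFin n)) ≡ ∑ f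
sum-allFin {n} f = trans (cong sum (map-tabulate (λ i → i) f)) (sum-tabulate f)
  where
  sum-tabulate : ∀ {k} (g : Fin k → ℕ) → sum (tabulate g) ≡ ∑ g
  sum-tabulate {zero} g = refl
  sum-tabulate {suc k} g = cong (g zero +_) (sum-tabulate (λ i → g (suc i)))

sum-filter : ∀ {A : Set} (p : A → Bool) (f : A → ℕ) (xs : List A) →
  sum (map f (filterᵇ p xs)) ≡ sum (map (λ x → if p x then f x else 0) xs)
sum-filter p f [] = refl
sum-filter p f (x ∷ xs) with p x
... | true = cong (f x +_) (sum-filter p f xs)
... | false = sum-filter p f xs

length-filter : ∀ {A : Set} (p : A → Bool) (xs : List A) →
  length (filterᵇ p xs) ≡ sum (map (λ x → if p x then 1 else 0) xs)
length-filter p [] = refl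
length-filter p (x ∷ xs) with p x
... | true = cong suc (length-filter p xs)
... | false = length-filter p xs

when : Bool → ℕ → ℕ
when b k = if b then k else 0

when-cong : ∀ b {k l} → (T b → k ≡ l) → when b k ≡ when b l
when-cong true h = h tt
when-cong false h = refl

when-mono : ∀ {b c} {k l} → (T b → T c × k ≤ l) → when b k ≤ when c l
when-mono {false} h = z≤n
when-mono {true} {true} h = proj₂ (h tt)
when-mono {true} {false} h = ⊥-elim (proj₁ (h tt))

when≤ : ∀ b k → when b k ≤ k
when≤ true k = ≤-refl
when≤ false k = z≤n

when-zero : ∀ b → when b 0 ≡ 0
when-zero true = refl
when-zero false = refl

δ : ∀ {k} → Fin k → ℕ → Fin k → ℕ
δ m a x = when ⌊ x F.≟ m ⌋ a

δ-suc : ∀ {k} (m x : Fin k) a → δ (suc m) a (suc x) ≡ δ m a x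
δ-suc m x a with x F.≟ m
... | yes _ = refl
... | no _ = refl

∑-δ : ∀ {k} (m : Fin k) a → ∑ (δ m a) ≡ a
∑-δ m a = trans (∑-single _ m off-m) at-m
  where
  off-m : ∀ x → x ≢ m → δ m a x ≡ 0
  off-m x x≢m with x F.≟ m
  ... | yes x≡m = ⊥-elim (x≢m x≡m)
  ... | no _ = refl
  at-m : δ m a m ≡ a
  at-m with m F.≟ m
  ... | yes _ = refl
  ... | no m≢m = ⊥-elim (m≢m refl)

𝟙 : Bool → ℕ
𝟙 b = when b 1

𝟙-mono : ∀ {a b} → (T a → T b) → 𝟙 a ≤ 𝟙 b
𝟙-mono {false} f = z≤n
𝟙-mono {true} {true} f = ≤-refl
𝟙-mono {true} {false} f = ⊥-elim (f tt)

𝟙-< : ∀ {a b} → ¬ T a → T b → 𝟙 a < 𝟙 b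
𝟙-< {false} {true} _ _ = s≤s z≤n
𝟙-< {true} f _ = ⊥-elim (f tt)

𝟙≤1 : ∀ b → 𝟙 b ≤ 1
𝟙≤1 true = ≤-refl
𝟙≤1 false = z≤n

𝟙-true : ∀ {b} → T b → 1 ≤ 𝟙 b
𝟙-true {true} _ = ≤-refl

module LatticeTheory (L : FinLattice) where
  open FinLattice L renaming (refl to le-refl; trans to le-trans; antisym to le-antisym)
  open LatticeNotions L

  infix 4 _⊑_ _⊏_ _⋖_ _⋖[_]_

  _⊑_ : Fin n → Fin n → Set
  x ⊑ y = T (le x y)

  _⊏_ : Fin n → Fin n → Set
  x ⊏ y = x ⊑ y × x ≢ y

  ⊑-refl : ∀ {x} → x ⊑ x
  ⊑-refl {x} = le-refl x

  ⊑-trans : ∀ {x y z} → x ⊑ y → y ⊑ z → x ⊑ z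
  ⊑-trans {x} {y} {z} = le-trans x y z

  ⊑-antisym : ∀ {x y} → x ⊑ y → y ⊑ x → x ≡ y
  ⊑-antisym {x} {y} = le-antisym x y

  ⊑∧⋢⇒⊏ : ∀ {x y} → x ⊑ y → ¬ y ⊑ x → x ⊏ y
  ⊑∧⋢⇒⊏ x⊑y y⋢x = x⊑y , λ { refl → y⋢x x⊑y }

  lt⇒⊏ : ∀ {x y} → T (lt x y) → x ⊏ y
  lt⇒⊏ {x} {y} h = T-∧₁ {le x y} h , λ x≡y → T-not-elim (T-∧₂ {le x y} h) (fromWitness x≡y)

  ⊏⇒lt : ∀ {x y} → x ⊏ y → T (lt x y)
  ⊏⇒lt {x} {y} (x⊑y , x≢y) = T-∧-intro {le x y} x⊑y (T-not-intro (λ h → x≢y (toWitness h)))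

  _⋖_ : Fin n → Fin n → Set
  x ⋖ y = x ⊏ y × (∀ z → x ⊏ z → z ⊏ y → ⊥)

  cover⇒⋖ : ∀ {x y} → T (cover x y) → x ⋖ y
  cover⇒⋖ {x} {y} h = lt⇒⊏ (T-∧₁ {lt x y} h) ,
    λ z x⊏z z⊏y → none-elim (λ z → lt x z ∧ lt z y) (T-∧₂ {lt x y} h) z (T-∧-intro {lt x z} (⊏⇒lt x⊏z) (⊏⇒lt z⊏y))

  ⋖⇒cover : ∀ {x y} → x ⋖ y → T (cover x y)
  ⋖⇒cover {x} {y} (x⊏y , nothing-between) = T-∧-intro {lt x y} (⊏⇒lt x⊏y)
    (none-intro (λ z → lt x z ∧ lt z y) (λ z h → nothing-between z (lt⇒⊏ (T-∧₁ {lt x z} h)) (lt⇒⊏ (T-∧₂ {lt x z} h))))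

  ⋖⇒⊑ : ∀ {x y} → x ⋖ y → x ⊑ y
  ⋖⇒⊑ c = proj₁ (proj₁ c)

  ⋖⇒≢ : ∀ {x y} → x ⋖ y → x ≢ y
  ⋖⇒≢ c = proj₂ (proj₁ c)

  ⋖-interval : ∀ {x y w} → x ⋖ y → x ⊑ w → w ⊑ y → w ≡ x ⊎ w ≡ y
  ⋖-interval {x} {y} {w} c x⊑w w⊑y with w F.≟ x | w F.≟ y
  ... | yes w≡x | _ = inj₁ w≡x
  ... | no _ | yes w≡y = inj₂ w≡y
  ... | no w≢x | no w≢y = ⊥-elim (proj₂ c w (x⊑w , λ e → w≢x (sym e)) (w⊑y , w≢y))

  -- Height (number of elements below) and coheight (number above) are
  -- strictly monotone; they make ⊏ well-founded in both directions.
  height : Fin n → ℕ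
  height x = ∑ (λ z → 𝟙 (le z x))

  coheight : Fin n → ℕ
  coheight x = ∑ (λ z → 𝟙 (le x z))

  height-< : ∀ {x y} → x ⊏ y → height x < height y
  height-< {x} {y} (x⊑y , x≢y) = ∑-mono-< _ _ (λ z → 𝟙-mono (λ z⊑x → ⊑-trans z⊑x x⊑y)) y
    (𝟙-< (λ y⊑x → x≢y (⊑-antisym x⊑y y⊑x)) ⊑-refl)

  coheight-< : ∀ {x y} → x ⊏ y → coheight y < coheight x
  coheight-< {x} {y} (x⊑y , x≢y) = ∑-mono-< _ _ (λ z → 𝟙-mono (λ y⊑z → ⊑-trans x⊑y y⊑z)) x
    (𝟙-< (λ y⊑x → x≢y (⊑-antisym x⊑y y⊑x)) ⊑-refl)

  height≤n : ∀ x → height x ≤ n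
  height≤n x = ≤-trans (∑-mono _ _ (λ z → 𝟙≤1 (le z x))) (≤-reflexive (∑-count n))

  ⊏-induction : (P : Fin n → Set) → (∀ x → (∀ y → y ⊏ x → P y) → P x) → ∀ x → P x
  ⊏-induction P step x = go x (<-wellFounded (height x))
    where
    go : ∀ x → Acc _<_ (height x) → P x
    go x (acc smaller) = step x (λ y y⊏x → go y (smaller (height-< y⊏x)))

  ⊐-induction : (P : Fin n → Set) → (∀ x → (∀ y → x ⊏ y → P y) → P x) → ∀ x → P x
  ⊐-induction P step x = go x (<-wellFounded (coheight x))
    where
    go : ∀ x → Acc _<_ (coheight x) → P x
    go x (acc smaller) = step x (λ y x⊏y → go y (smaller (coheight-< x⊏y)))

  minimal-below : (P : Fin n → Bool) (z : Fin n) → T (P z) →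
    ∃ λ a → a ⊑ z × T (P a) × (∀ b → b ⊏ a → ¬ T (P b))
  minimal-below P = ⊏-induction _ step
    where
    step : ∀ z → (∀ y → y ⊏ z → T (P y) → ∃ λ a → a ⊑ y × T (P a) × (∀ b → b ⊏ a → ¬ T (P b))) →
           T (P z) → ∃ λ a → a ⊑ z × T (P a) × (∀ b → b ⊏ a → ¬ T (P b))
    step z ih pz with T? (any (λ b → lt b z ∧ P b) X)
    ... | yes h =
      let (b , hb) = any-witness (λ b → lt b z ∧ P b) h
          b⊏z = lt⇒⊏ (T-∧₁ {lt b z} hb)
          (a , a⊑b , pa , minimal) = ih b b⊏z (T-∧₂ {lt b z} hb)
      in a , ⊑-trans a⊑b (proj₁ b⊏z) , pa , minimal
    ... | no h = z , ⊑-refl , pz ,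
      λ b b⊏z pb → h (any-intro (λ b → lt b z ∧ P b) b (T-∧-intro {lt b z} (⊏⇒lt b⊏z) pb))

  maximal-above : (P : Fin n → Bool) (z : Fin n) → T (P z) →
    ∃ λ a → z ⊑ a × T (P a) × (∀ b → a ⊏ b → ¬ T (P b))
  maximal-above P = ⊐-induction _ step
    where
    step : ∀ z → (∀ y → z ⊏ y → T (P y) → ∃ λ a → y ⊑ a × T (P a) × (∀ b → a ⊏ b → ¬ T (P b))) →
           T (P z) → ∃ λ a → z ⊑ a × T (P a) × (∀ b → a ⊏ b → ¬ T (P b))
    step z ih pz with T? (any (λ b → lt z b ∧ P b) X)
    ... | yes h =
      let (b , hb) = any-witness (λ b → lt z b ∧ P b) h
          z⊏b = lt⇒⊏ (T-∧₁ {lt z b} hb)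
          (a , b⊑a , pa , maximal) = ih b z⊏b (T-∧₂ {lt z b} hb)
      in a , ⊑-trans (proj₁ z⊏b) b⊑a , pa , maximal
    ... | no h = z , ⊑-refl , pz ,
      λ b z⊏b pb → h (any-intro (λ b → lt z b ∧ P b) b (T-∧-intro {lt z b} (⊏⇒lt z⊏b) pb))

  cover-below : ∀ {x y} → x ⊏ y → ∃ λ c → x ⋖ c × c ⊑ y
  cover-below {x} {y} x⊏y =
    let (c , c⊑y , pc , minimal) = minimal-below (λ c → lt x c ∧ le c y) y (T-∧-intro {lt x y} (⊏⇒lt x⊏y) ⊑-refl)
    in c , (lt⇒⊏ (T-∧₁ {lt x c} pc) ,
            λ z x⊏z z⊏c → minimal z z⊏c (T-∧-intro {lt x z} (⊏⇒lt x⊏z) (⊑-trans (proj₁ z⊏c) (T-∧₂ {lt x c} pc)))) ,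
       T-∧₂ {lt x c} pc

  meet-≡₁ : ∀ {u v} → u ⊑ v → meet u v ≡ u
  meet-≡₁ {u} {v} u⊑v = ⊑-antisym (meet-lb₁ u v) (meet-greatest u v u ⊑-refl u⊑v)

  meet-≡₂ : ∀ {u v} → v ⊑ u → meet u v ≡ v
  meet-≡₂ {u} {v} v⊑u = ⊑-antisym (meet-lb₂ u v) (meet-greatest u v v v⊑u ⊑-refl)

  join-≡₁ : ∀ {u v} → v ⊑ u → join u v ≡ u
  join-≡₁ {u} {v} v⊑u = ⊑-antisym (join-least u v u ⊑-refl v⊑u) (join-ub₁ u v)

  -- Meet-irreducibles are exactly the elements with a unique upper cover.
  upperCoverCount : Fin n → ℕ
  upperCoverCount m = ∑ (λ x → 𝟙 (cover m x))

  upperCovers-length : ∀ m → length (filterᵇ (cover m) X) ≡ upperCoverCount m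
  upperCovers-length m = trans (length-filter (cover m) X) (sum-allFin (λ x → 𝟙 (cover m x)))

  unique-cover⇒M : ∀ {m c} → m ⋖ c → (∀ c' → m ⋖ c' → c' ≡ c) → T (isM m)
  unique-cover⇒M {m} {c} m⋖c unique = subst (λ k → T (k ≡ᵇ 1)) (sym count≡1) tt
    where
    count≡1 : length (filterᵇ (cover m) X) ≡ 1
    count≡1 = trans (upperCovers-length m) (trans (∑-single (λ x → 𝟙 (cover m x)) c
      (λ x x≢c → cong 𝟙 (¬T⇒≡false (λ h → x≢c (unique x (cover⇒⋖ h)))))) (cong 𝟙 (T⇒≡true (⋖⇒cover m⋖c))))

  M⇒unique-cover : ∀ {m} → T (isM m) → ∃ λ c → m ⋖ c × (∀ c' → m ⋖ c' → c' ≡ c)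
  M⇒unique-cover {m} h = let (c , m⋖c) = some-cover in c , cover⇒⋖ m⋖c , λ c' m⋖c' → at-most-one m⋖c' m⋖c
    where
    count≡1 : upperCoverCount m ≡ 1
    count≡1 = trans (sym (upperCovers-length m)) (≡ᵇ⇒≡ _ 1 h)
    some-cover : ∃ λ c → T (cover m c)
    some-cover with T? (any (cover m) X)
    ... | yes h = any-witness (cover m) h
    ... | no h = ⊥-elim (0≢1+n (trans (sym (∑-zero _ (λ x → cong 𝟙 (¬T⇒≡false (λ m⋖x → h (any-intro (cover m) x m⋖x)))))) count≡1))
    at-most-one : ∀ {c' c} → m ⋖ c' → T (cover m c) → c' ≡ c
    at-most-one {c'} {c} m⋖c' m⋖c = decidable-stable (c' F.≟ c) λ c'≢c →
      <-irrefl refl (≤-trans (∑-two _ c' c c'≢c (𝟙-true (⋖⇒cover m⋖c')) (𝟙-true m⋖c)) (≤-reflexive count≡1))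

  covers-⊑⇒≡ : ∀ {t a b} → t ⋖ a → t ⋖ b → b ⊑ a → b ≡ a
  covers-⊑⇒≡ t⋖a t⋖b b⊑a with ⋖-interval t⋖a (⋖⇒⊑ t⋖b) b⊑a
  ... | inj₁ b≡t = ⊥-elim (⋖⇒≢ t⋖b (sym b≡t))
  ... | inj₂ b≡a = b≡a

  covers-meet : ∀ {t a b} → t ⋖ a → t ⋖ b → a ≢ b → meet a b ≡ t
  covers-meet {t} {a} {b} t⋖a t⋖b a≢b
    with ⋖-interval t⋖a (meet-greatest a b t (⋖⇒⊑ t⋖a) (⋖⇒⊑ t⋖b)) (meet-lb₁ a b)
  ... | inj₁ ab≡t = ab≡t
  ... | inj₂ ab≡a = ⊥-elim (a≢b (covers-⊑⇒≡ t⋖b t⋖a (subst (_⊑ b) ab≡a (meet-lb₂ a b))))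

  -- An element m avoiding x (x ⋢ m) whose upper covers all lie above x is
  -- meet-irreducible: two distinct upper covers would meet in m ⊒ x.
  maximal-avoiding⇒M : ∀ {x m} → ¬ x ⊑ m → (∀ c → m ⋖ c → x ⊑ c) → T (isM m)
  maximal-avoiding⇒M {x} {m} x⋢m covers-above-x =
    let (c , m⋖c , _) = cover-below m⊏m∨x in unique-cover⇒M m⋖c (λ c' m⋖c' → unique m⋖c' m⋖c)
    where
    m⊏m∨x : m ⊏ join m x
    m⊏m∨x = ⊑∧⋢⇒⊏ (join-ub₁ m x) (λ mx⊑m → x⋢m (⊑-trans (join-ub₂ m x) mx⊑m))
    unique : ∀ {c' c} → m ⋖ c' → m ⋖ c → c' ≡ c
    unique {c'} {c} m⋖c' m⋖c = decidable-stable (c' F.≟ c) λ c'≢c →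
      x⋢m (subst (x ⊑_) (covers-meet m⋖c' m⋖c c'≢c) (meet-greatest c' c x (covers-above-x c' m⋖c') (covers-above-x c m⋖c)))

  -- Separation: if x ⋢ y then some meet-irreducible lies above y but not
  -- above x, namely any m maximal among the elements above y avoiding x.
  separation : ∀ {x y} → ¬ x ⊑ y → ∃ λ m → T (isM m) × y ⊑ m × ¬ x ⊑ m
  separation {x} {y} x⋢y =
    let (m , y⊑m , avoids , maximal) = maximal-above (λ u → le y u ∧ not (le x u)) y (T-∧-intro {le y y} ⊑-refl (T-not-intro x⋢y))
        x⋢m = T-not-elim (T-∧₂ {le y m} avoids)
        covers-above-x : ∀ c → m ⋖ c → x ⊑ c
        covers-above-x c m⋖c = T-not-not (λ x⋢c → maximal c (proj₁ m⋖c) (T-∧-intro {le y c} (⊑-trans y⊑m (⋖⇒⊑ m⋖c)) x⋢c))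
    in m , maximal-avoiding⇒M x⋢m covers-above-x , y⊑m , x⋢m

  M-determines-order : ∀ {x y} → (∀ m → T (isM m) → x ⊑ m → y ⊑ m) → y ⊑ x
  M-determines-order {x} {y} h = decidable-stable (T? (le y x)) λ y⋢x →
    let (m , m∈M , x⊑m , y⋢m) = separation y⋢x in y⋢m (h m m∈M x⊑m)

  _⋖[_]_ : Fin n → Fin n → Fin n → Set
  x ⋖[ m ] y = x ⋖ y × T (isM m) × x ⊑ m × ¬ y ⊑ m

  cover-has-label : ∀ {x y} → x ⋖ y → ∃ λ m → x ⋖[ m ] y
  cover-has-label {x} {y} x⋖y =
    let (m , m∈M , x⊑m , y⋢m) = separation {y} {x} (λ y⊑x → ⋖⇒≢ x⋖y (⊑-antisym (⋖⇒⊑ x⋖y) y⊑x))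
    in m , x⋖y , m∈M , x⊑m , y⋢m

module LabelSets (L : FinLattice) where
  open FinLattice L using (bot; le)
  open LatticeNotions L
  open LatticeTheory L

  starts-label⇒cover : ∀ {m x} → T (startsLabel m x) → ∃ λ y → x ⋖[ m ] y
  starts-label⇒cover {m} {x} h =
    let (y , labelled) = any-witness (labelledBy m x) h
        rest = T-∧₂ {cover x y} labelled
        rest' = T-∧₂ {isM m} rest
    in y , cover⇒⋖ (T-∧₁ {cover x y} labelled) , T-∧₁ {isM m} rest , T-∧₁ {le x m} rest' , T-not-elim (T-∧₂ {le x m} rest')

  cover⇒starts-label : ∀ {m x y} → x ⋖[ m ] y → T (startsLabel m x)
  cover⇒starts-label {m} {x} {y} (x⋖y , m∈M , x⊑m , y⋢m) = any-intro (labelledBy m x) y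
    (T-∧-intro {cover x y} (⋖⇒cover x⋖y) (T-∧-intro {isM m} m∈M (T-∧-intro {le x m} x⊑m (T-not-intro y⋢m))))

  U⇒starts-label : ∀ {m a} → T (inU m a) → T (startsLabel m a)
  U⇒starts-label {m} {a} h = T-∧₁ {startsLabel m a} h

  U-below : ∀ {m z} → T (startsLabel m z) → ∃ λ a → T (inU m a) × a ⊑ z
  U-below {m} {z} h =
    let (a , a⊑z , pa , minimal) = minimal-below (startsLabel m) z h
    in a , T-∧-intro {startsLabel m a} pa (none-intro (λ b → lt b a ∧ startsLabel m b)
             (λ b hb → minimal b (lt⇒⊏ (T-∧₁ {lt b a} hb)) (T-∧₂ {lt b a} hb))) , a⊑z

  bot∈U : ∀ {m} → T (UisBot m) → T (inU m bot)
  bot∈U {m} h with T-∨-elim {inU m bot ∧ eqᵇ bot bot}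
                     (all-elim (λ x → (inU m x ∧ eqᵇ x bot) ∨ (not (inU m x) ∧ not (eqᵇ x bot))) h bot)
  ... | inj₁ p = T-∧₁ {inU m bot} p
  ... | inj₂ p = ⊥-elim (T-not-elim (T-∧₂ {not (inU m bot)} p) (fromWitness refl))

  above-U-or-below-L : ∀ m y → (∃ λ a → T (inU m a) × a ⊑ y) ⊎ (∃ λ l → T (inL m l) × y ⊑ l)
  above-U-or-below-L m y with T? (any (λ a → inU m a ∧ le a y) X)
  ... | yes h = let (a , ha) = any-witness (λ a → inU m a ∧ le a y) h in inj₁ (a , T-∧₁ {inU m a} ha , T-∧₂ {inU m a} ha)
  ... | no h =
    let (l , y⊑l , outside , maximal) = maximal-above (outsideUp m) y (T-not-intro h)
    in inj₂ (l , T-∧-intro {outsideUp m l} outside (none-intro (λ z → lt l z ∧ outsideUp m z)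
                   (λ z hz → maximal z (lt⇒⊏ (T-∧₁ {lt l z} hz)) (T-∧₂ {lt l z} hz))) , y⊑l)

module UpperLocallyDistributiveTheory (L : FinLattice) (uld : LatticeNotions.UpperLocallyDistributive L) where
  open FinLattice L using (n; bot; bot-least; le; join; join-ub₁; join-ub₂; join-least; meet; meet-lb₂; meet-greatest)
  open LatticeNotions L
  open LatticeTheory L
  open LabelSets L

  joinCovers : Fin n → List (Fin n) → Fin n
  joinCovers t = foldr (λ y acc → if cover t y then join y acc else acc) bot

  _⁺ : Fin n → Fin n
  t ⁺ = joinCovers t X

  ⁺-isJoin : ∀ t → IsJoinOfUpperCovers t (t ⁺)
  ⁺-isJoin t = (λ y h → upper t (∈-allFin y) h) , (λ q f → least t q X f)
    where
    upper : ∀ t {y} {xs} → y ∈ xs → T (cover t y) → y ⊑ joinCovers t xs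
    upper t {y} (here refl) h rewrite T⇒≡true h = join-ub₁ y _
    upper t {y} {x ∷ xs} (there y∈xs) h with cover t x
    ... | true = ⊑-trans (upper t y∈xs h) (join-ub₂ x _)
    ... | false = upper t y∈xs h
    least : ∀ t q xs → (∀ y → T (cover t y) → y ⊑ q) → joinCovers t xs ⊑ q
    least t q [] f = bot-least q
    least t q (x ∷ xs) f with T? (cover t x)
    ... | yes h rewrite T⇒≡true h = join-least x _ q (f x h) (least t q xs f)
    ... | no h rewrite ¬T⇒≡false h = least t q xs f

  cover-in-⁺ : ∀ {t a} → t ⋖ a → InInterval t (t ⁺) a
  cover-in-⁺ {t} t⋖a = ⋖⇒⊑ t⋖a , proj₁ (⁺-isJoin t) _ (⋖⇒cover t⋖a)

  distrib-⁺ : ∀ {t a} → t ⋖ a → ∀ {u v w} → InInterval t (t ⁺) u → InInterval t (t ⁺) v → InInterval t (t ⁺) w →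
    meet u (join v w) ≡ join (meet u v) (meet u w)
  distrib-⁺ {t} {a} t⋖a {u} {v} {w} = proj₁ (uld t t-not-top (t ⁺) (⁺-isJoin t)) u v w
    where
    t-not-top : ¬ IsTop t
    t-not-top top = ⋖⇒≢ t⋖a (⊑-antisym (⋖⇒⊑ t⋖a) (top a))

  covers-join-covers : ∀ {t a b} → t ⋖ a → t ⋖ b → a ≢ b → a ⋖ join a b
  covers-join-covers {t} {a} {b} t⋖a t⋖b a≢b =
    ⊑∧⋢⇒⊏ (join-ub₁ a b) (λ ab⊑a → a≢b (sym (covers-⊑⇒≡ t⋖a t⋖b (⊑-trans (join-ub₂ a b) ab⊑a)))) ,
    nothing-between
    where
    ab⊑t⁺ : join a b ⊑ t ⁺
    ab⊑t⁺ = join-least a b _ (proj₂ (cover-in-⁺ t⋖a)) (proj₂ (cover-in-⁺ t⋖b))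
    -- inside [a, a ∨ b] every z is a ∨ (z ∧ b), by distributivity in [t, t⁺]
    z≡a∨[z∧b] : ∀ {z} → a ⊑ z → z ⊑ join a b → z ≡ join a (meet z b)
    z≡a∨[z∧b] {z} a⊑z z⊑ab = begin
      z                          ≡⟨ sym (meet-≡₁ z⊑ab) ⟩
      meet z (join a b)          ≡⟨ distrib-⁺ t⋖a (⊑-trans (⋖⇒⊑ t⋖a) a⊑z , ⊑-trans z⊑ab ab⊑t⁺)
                                               (cover-in-⁺ t⋖a) (cover-in-⁺ t⋖b) ⟩
      join (meet z a) (meet z b) ≡⟨ cong (λ q → join q (meet z b)) (meet-≡₂ a⊑z) ⟩
      join a (meet z b)          ∎
      where open ≡-Reasoning
    nothing-between : ∀ z → a ⊏ z → z ⊏ join a b → ⊥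
    nothing-between z (a⊑z , a≢z) (z⊑ab , z≢ab)
      with ⋖-interval t⋖b (meet-greatest z b t (⊑-trans (⋖⇒⊑ t⋖a) a⊑z) (⋖⇒⊑ t⋖b)) (meet-lb₂ z b)
    ... | inj₁ zb≡t = a≢z (sym (trans (z≡a∨[z∧b] a⊑z z⊑ab) (trans (cong (join a) zb≡t) (join-≡₁ (⋖⇒⊑ t⋖a)))))
    ... | inj₂ zb≡b = z≢ab (trans (z≡a∨[z∧b] a⊑z z⊑ab) (cong (join a) zb≡b))

  -- For upper covers a, b, c of t with a ≠ b ≠ c, the joins c ∨ a and
  -- c ∨ b differ: otherwise b = b ∧ (c ∨ a) = (b ∧ c) ∨ (b ∧ a) = t.
  cover-joins-differ : ∀ {t a b c} → t ⋖ a → t ⋖ b → t ⋖ c → a ≢ b → b ≢ c → join c a ≢ join c b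
  cover-joins-differ {t} {a} {b} {c} t⋖a t⋖b t⋖c a≢b b≢c ca≡cb = ⋖⇒≢ t⋖b (sym b≡t)
    where
    open ≡-Reasoning
    b⊑ca : b ⊑ join c a
    b⊑ca = subst (b ⊑_) (sym ca≡cb) (join-ub₂ c b)
    b≡t : b ≡ t
    b≡t = begin
      b                          ≡⟨ sym (meet-≡₁ b⊑ca) ⟩
      meet b (join c a)          ≡⟨ distrib-⁺ t⋖a (cover-in-⁺ t⋖b) (cover-in-⁺ t⋖c) (cover-in-⁺ t⋖a) ⟩
      join (meet b c) (meet b a) ≡⟨ cong₂ join (covers-meet t⋖b t⋖c b≢c) (covers-meet t⋖b t⋖a (λ e → a≢b (sym e))) ⟩
      join t t                   ≡⟨ join-≡₁ ⊑-refl ⟩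
      t                          ∎

  -- Induction upwards
  -- on t: if t = m then m has only one upper cover; otherwise an upper
  -- cover c ⊑ m of t has the covers c ∨ a, c ∨ b with the same label,
  -- equal by induction, which forces a = b by cover-joins-differ.
  same-label⇒same-cover : ∀ t {a b m} → t ⋖[ m ] a → t ⋖[ m ] b → a ≡ b
  same-label⇒same-cover = ⊐-induction _ step
    where
    step : ∀ t → (∀ c → t ⊏ c → ∀ {a b m} → c ⋖[ m ] a → c ⋖[ m ] b → a ≡ b) →
           ∀ {a b m} → t ⋖[ m ] a → t ⋖[ m ] b → a ≡ b
    step t ih {a} {b} {m} (t⋖a , m∈M , t⊑m , a⋢m) (t⋖b , _ , _ , b⋢m) with a F.≟ b | t F.≟ m
    ... | yes a≡b | _ = a≡b
    ... | no _ | yes refl = let (_ , _ , unique) = M⇒unique-cover m∈M in trans (unique a t⋖a) (sym (unique b t⋖b))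
    ... | no a≢b | no t≢m =
      let (c , t⋖c , c⊑m) = cover-below (t⊑m , t≢m)
          c≢a = λ c≡a → a⋢m (subst (_⊑ m) c≡a c⊑m)
          c≢b = λ c≡b → b⋢m (subst (_⊑ m) c≡b c⊑m)
          ca≡cb = ih c (proj₁ t⋖c)
            (covers-join-covers t⋖c t⋖a c≢a , m∈M , c⊑m , λ ca⊑m → a⋢m (⊑-trans (join-ub₂ c a) ca⊑m))
            (covers-join-covers t⋖c t⋖b c≢b , m∈M , c⊑m , λ cb⊑m → b⋢m (⊑-trans (join-ub₂ c b) cb⊑m))
      in ⊥-elim (cover-joins-differ t⋖a t⋖b t⋖c a≢b (λ b≡c → c≢b (sym b≡c)) ca≡cb)

  M-labels-its-cover : ∀ {x y m} → T (isM x) → x ⋖[ m ] y → x ≡ m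
  M-labels-its-cover {x} {y} {m} x∈M (x⋖y , _ , x⊑m , y⋢m) with x F.≟ m
  ... | yes x≡m = x≡m
  ... | no x≢m =
    let (c , x⋖c , c⊑m) = cover-below (x⊑m , x≢m)
        (_ , _ , unique) = M⇒unique-cover x∈M
    in ⊥-elim (y⋢m (subst (_⊑ m) (trans (unique c x⋖c) (sym (unique y x⋖y))) c⊑m))

  -- Induction upwards on x: pass to an upper cover z ⊑ m₁ of x;
  -- if z ⊑ m₂ both labels move to the cover z ⋖ z ∨ y, and otherwise y and
  -- z would be distinct covers of x with the same label m₂.
  label-unique : ∀ x {y m₁ m₂} → x ⋖[ m₁ ] y → x ⋖[ m₂ ] y → m₁ ≡ m₂
  label-unique = ⊐-induction _ step
    where
    step : ∀ x → (∀ z → x ⊏ z → ∀ {y m₁ m₂} → z ⋖[ m₁ ] y → z ⋖[ m₂ ] y → m₁ ≡ m₂) →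
           ∀ {y m₁ m₂} → x ⋖[ m₁ ] y → x ⋖[ m₂ ] y → m₁ ≡ m₂
    step x ih {y} {m₁} {m₂} lab₁@(x⋖y , m₁∈M , x⊑m₁ , y⋢m₁) lab₂@(_ , m₂∈M , x⊑m₂ , y⋢m₂) with x F.≟ m₁ | x F.≟ m₂
    ... | yes refl | _ = M-labels-its-cover m₁∈M lab₂
    ... | no _ | yes refl = sym (M-labels-its-cover m₂∈M lab₁)
    ... | no x≢m₁ | no _ with cover-below (x⊑m₁ , x≢m₁)
    ...   | z , x⋖z , z⊑m₁ with T? (le z m₂)
    ...     | yes z⊑m₂ = ih z (proj₁ x⋖z) (z⋖zy , m₁∈M , z⊑m₁ , λ zy⊑m₁ → y⋢m₁ (⊑-trans (join-ub₂ z y) zy⊑m₁))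
                                            (z⋖zy , m₂∈M , z⊑m₂ , λ zy⊑m₂ → y⋢m₂ (⊑-trans (join-ub₂ z y) zy⊑m₂))
      where
      z⋖zy : z ⋖ join z y
      z⋖zy = covers-join-covers x⋖z x⋖y (λ z≡y → y⋢m₁ (subst (_⊑ m₁) z≡y z⊑m₁))
    ...     | no z⋢m₂ = ⊥-elim (y⋢m₁ (subst (_⊑ m₁) (same-label⇒same-cover x (x⋖z , m₂∈M , x⊑m₂ , z⋢m₂) lab₂) z⊑m₁))

  extension : ∀ {a a' y m} → a ⋖[ m ] a' → a ⊑ y → y ⊑ m → y ⋖[ m ] join y a'
  extension {a} {a'} {y} {m} lab@(a⋖a' , m∈M , a⊑m , a'⋢m) a⊑y y⊑m =
    (⊑∧⋢⇒⊏ (join-ub₁ y a') (λ ya'⊑y → ya'⋢m (⊑-trans ya'⊑y y⊑m)) , nothing-between) , m∈M , y⊑m , ya'⋢m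
    where
    ya'⋢m : ¬ join y a' ⊑ m
    ya'⋢m h = a'⋢m (⊑-trans (join-ub₂ y a') h)
    -- every m₁ ∈ M separating y from y ∨ a' is a label of a ⋖ a', hence is m
    only-label : ∀ {m₁} → T (isM m₁) → y ⊑ m₁ → ¬ join y a' ⊑ m₁ → m₁ ≡ m
    only-label m₁∈M y⊑m₁ ya'⋢m₁ =
      label-unique a (a⋖a' , m₁∈M , ⊑-trans a⊑y y⊑m₁ , λ a'⊑m₁ → ya'⋢m₁ (join-least y a' _ y⊑m₁ a'⊑m₁)) lab
    nothing-between : ∀ z → y ⊏ z → z ⊏ join y a' → ⊥
    nothing-between z (y⊑z , y≢z) (z⊑ya' , z≢ya') =
      let (m₁ , m₁∈M , y⊑m₁ , z⋢m₁) = separation {z} {y} (λ z⊑y → y≢z (⊑-antisym y⊑z z⊑y))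
          (m₂ , m₂∈M , z⊑m₂ , ya'⋢m₂) = separation {join y a'} {z} (λ ya'⊑z → z≢ya' (⊑-antisym z⊑ya' ya'⊑z))
          m₁≡m = only-label m₁∈M y⊑m₁ (λ ya'⊑m₁ → z⋢m₁ (⊑-trans z⊑ya' ya'⊑m₁))
          m₂≡m = only-label m₂∈M (⊑-trans y⊑z z⊑m₂) ya'⋢m₂
      in z⋢m₁ (subst (z ⊑_) (trans m₂≡m (sym m₁≡m)) z⊑m₂)

  U-below⇒labelled-cover : ∀ {m a y} → T (inU m a) → a ⊑ y → y ⊑ m → ∃ λ y' → y ⋖[ m ] y'
  U-below⇒labelled-cover a∈U a⊑y y⊑m =
    let (a' , a⋖a') = starts-label⇒cover (U⇒starts-label a∈U)
    in _ , extension a⋖a' a⊑y y⊑m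

-- The vertices are a sink 0 and
-- one vertex suc m per element m of L (only meet-irreducibles matter).
module Sandpile (L : FinLattice) (uld : LatticeNotions.UpperLocallyDistributive L)
                (Ω-solution : LatticeNotions.OmegaSolvable L) where
  open FinLattice L using (n; bot; bot-least; le; meet; meet-lb₁; meet-lb₂; meet-greatest)
  open LatticeNotions L
  open LatticeTheory L
  open UpperLocallyDistributiveTheory L uld
  open LabelSets L

  w : Fin n → ℕ
  w = proj₁ Ω-solution

  e : Fin n → Fin n → ℕ
  e = proj₁ (proj₂ Ω-solution)

  w≤sumE : ∀ {m a} → T (isM m) → ¬ T (UisBot m) → T (inU m a) → w m ≤ sumE e m a
  w≤sumE {m} m∈M not-bot a∈U with UisBot m | proj₁ (proj₂ (proj₂ Ω-solution)) m m∈M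
  ... | true | _ = ⊥-elim (not-bot tt)
  ... | false | (_ , U-ineqs) = U-ineqs _ a∈U

  sumE<w : ∀ {m l} → T (isM m) → ¬ T (UisBot m) → T (inL m l) → sumE e m l < w m
  sumE<w {m} m∈M not-bot l∈L with UisBot m | proj₁ (proj₂ (proj₂ Ω-solution)) m m∈M
  ... | true | _ = ⊥-elim (not-bot tt)
  ... | false | (L-ineqs , _) = L-ineqs _ l∈L

  -- Edge multiplicities: e_{x,m} on the variables of Ω, read symmetrically
  -- (Ω identifies e_{x,m} and e_{m,x} when both are variables), else 0.
  edge : Fin n → Fin n → ℕ
  edge x m = if eVarInU x m then e x m else when (eVarInU m x) (e m x)

  edge-var : ∀ {x m} → T (eVarInU x m) → edge x m ≡ e x m
  edge-var h = if-true h

  edge-sym : ∀ x m → edge x m ≡ edge m x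
  edge-sym x m = select-sym (eVarInU x m) (eVarInU m x) (proj₂ (proj₂ (proj₂ Ω-solution)) x m)
    where
    select-sym : ∀ b c {u v} → (T b → T c → u ≡ v) → (if b then u else when c v) ≡ (if c then v else when b u)
    select-sym true true h = h tt tt
    select-sym true false h = refl
    select-sym false true h = refl
    select-sym false false h = refl

  edge-into-non-M : ∀ {x m} → ¬ T (isM m) → edge x m ≡ 0
  edge-into-non-M {x} {m} m∉M =
    trans (if-false (λ h → m∉M (T-∧₁ {isM m} h)))
          (if-false (λ h → m∉M (T-∧₁ {isM m} (T-∧₂ {not (UisBot x)} (T-∧₂ {isM x} h)))))

  -- Every vertex sends 2·big chips to the sink, where big exceeds every
  -- w_m and every total inflow; this separates fired from unfired vertices.
  totalInflow : Fin n → ℕ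
  totalInflow m = ∑ (λ x → edge x m)

  opaque
    big : ℕ
    big = suc (∑ (λ m → totalInflow m + w m))

    totalInflow<big : ∀ m → totalInflow m < big
    totalInflow<big m = s≤s (≤-trans (m≤m+n _ _) (term≤∑ (λ m → totalInflow m + w m) m))

    w<big : ∀ m → w m < big
    w<big m = s≤s (≤-trans (m≤n+m _ _) (term≤∑ (λ m → totalInflow m + w m) m))

    0<big : 0 < big
    0<big = s≤s z≤n

  graph : Multigraph (suc n)
  graph zero _ = 0
  graph (suc x) zero = big + big
  graph (suc x) (suc m) = edge x m

  open CFG graph

  degree : Fin n → ℕ
  degree m = outdeg (suc m)

  2big≤degree : ∀ m → big + big ≤ degree m
  2big≤degree m = subst (big + big ≤_) (sym (sum-allFin (graph (suc m)))) (m≤m+n _ _)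

  big≤degree : ∀ m → big ≤ degree m
  big≤degree m = ≤-trans (m≤m+n big big) (2big≤degree m)

  w≤degree : ∀ m → w m ≤ degree m
  w≤degree m = ≤-trans (<⇒≤ (w<big m)) (big≤degree m)

  -- fired y x: x ∈ M ∖ M_y, the vertices fired on the way from 𝟎 to y.
  fired : Fin n → Fin n → Bool
  fired y x = isM x ∧ not (le y x)

  fired-intro : ∀ {y x} → T (isM x) → ¬ y ⊑ x → T (fired y x)
  fired-intro {y} {x} x∈M y⋢x = T-∧-intro {isM x} x∈M (T-not-intro y⋢x)

  fired-M : ∀ {y x} → T (fired y x) → T (isM x)
  fired-M {y} {x} h = T-∧₁ {isM x} h

  fired-⋢ : ∀ {y x} → T (fired y x) → ¬ y ⊑ x
  fired-⋢ {y} {x} h = T-not-elim (T-∧₂ {isM x} h)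

  fired-mono : ∀ {y y' x} → y ⊑ y' → T (fired y x) → T (fired y' x)
  fired-mono {y} {y'} {x} y⊑y' h = fired-intro (fired-M {y} h) (λ y'⊑x → fired-⋢ {y} h (⊑-trans y⊑y' y'⊑x))

  -- Chips received by m from the vertices fired on the way to y.
  inflow : Fin n → Fin n → ℕ
  inflow y m = ∑ (λ x → when (fired y x) (edge x m))

  inflow-mono : ∀ {y y'} m → y ⊑ y' → inflow y m ≤ inflow y' m
  inflow-mono {y} {y'} m y⊑y' = ∑-mono _ _ (λ x → when-mono (λ h → fired-mono {y} {y'} {x} y⊑y' h , ≤-refl))

  inflow≤total : ∀ y m → inflow y m ≤ totalInflow m
  inflow≤total y m = ∑-mono _ _ (λ x → when≤ (fired y x) (edge x m))

  inflow-non-M : ∀ y {m} → ¬ T (isM m) → inflow y m ≡ 0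
  inflow-non-M y m∉M = ∑-zero _ (λ x → trans (when-cong (fired y x) (λ _ → edge-into-non-M m∉M)) (when-zero (fired y x)))

  sumE≡inflow : ∀ {m a} → T (isM m) → ¬ T (UisBot m) → T (inU m a ∨ inL m a) → sumE e m a ≡ inflow a m
  sumE≡inflow {m} {a} m∈M not-bot a∈U∪L =
    trans (sum-filter (fired a) (λ x → e x m) X)
      (trans (sum-allFin (λ x → when (fired a x) (e x m)))
        (sum-cong-≗ (λ x → when-cong (fired a x) (λ h → sym (edge-var (is-variable h))))))
    where
    is-variable : ∀ {x} → T (fired a x) → T (eVarInU x m)
    is-variable {x} h =
      T-∧-intro {isM m} m∈M (T-∧-intro {not (UisBot m)} (T-not-intro not-bot) (T-∧-intro {isM x} (fired-M {a} h)
        (any-intro (λ a → (inU m a ∨ inL m a) ∧ not (le a x)) a (T-∧-intro {inU m a ∨ inL m a} a∈U∪L (T-not-intro (fired-⋢ {a} h))))))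

  base : Fin n → ℕ
  base m = when (isM m) (if UisBot m then degree m else degree m ∸ w m)

  base-bot : ∀ {m} → T (isM m) → T (UisBot m) → base m ≡ degree m
  base-bot m∈M bot = trans (if-true m∈M) (if-true bot)

  base-not-bot : ∀ {m} → T (isM m) → ¬ T (UisBot m) → base m ≡ degree m ∸ w m
  base-not-bot m∈M not-bot = trans (if-true m∈M) (if-false not-bot)

  base-non-M : ∀ {m} → ¬ T (isM m) → base m ≡ 0
  base-non-M m∉M = if-false m∉M

  big≤base : ∀ {m} → T (isM m) → big ≤ base m
  big≤base {m} m∈M = case T? (UisBot m) of λ where
    (yes bot) → subst (big ≤_) (sym (base-bot m∈M bot)) (big≤degree m)
    (no not-bot) → subst (big ≤_) (sym (base-not-bot m∈M not-bot))
      (m+n≤o⇒m≤o∸n big (≤-trans (+-monoʳ-≤ big (<⇒≤ (w<big m))) (2big≤degree m)))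

  base≤degree : ∀ m → base m ≤ degree m
  base≤degree m with T? (isM m) | T? (UisBot m)
  ... | yes m∈M | yes bot = ≤-reflexive (base-bot m∈M bot)
  ... | yes m∈M | no not-bot = subst (_≤ degree m) (sym (base-not-bot m∈M not-bot)) (m∸n≤m (degree m) (w m))
  ... | no m∉M | _ = subst (_≤ degree m) (sym (base-non-M m∉M)) z≤n

  -- level y m: the chips m would hold at y had it never fired;
  -- debt y m: the chips it gave away if it has fired.
  level : Fin n → Fin n → ℕ
  level y m = base m + inflow y m

  debt : Fin n → Fin n → ℕ
  debt y m = when (fired y m) (degree m)

  φ : Fin n → Config (suc n)
  φ y zero = ∑ (λ x → when (fired y x) (big + big))
  φ y (suc m) = level y m ∸ debt y m

  -- Firability from 𝔘_m: if a ∈ 𝔘_m lies below y then m holds at least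
  -- deg(m) chips at y, by the 𝔘-inequalities of Ω.
  U-below⇒level≥degree : ∀ {m a y} → T (isM m) → T (inU m a) → a ⊑ y → degree m ≤ level y m
  U-below⇒level≥degree {m} {a} {y} m∈M a∈U a⊑y = by-cases (T? (UisBot m))
    where
    open ≤-Reasoning
    by-cases : Dec (T (UisBot m)) → degree m ≤ level y m
    by-cases (yes bot) = subst (λ b → degree m ≤ b + inflow y m) (sym (base-bot m∈M bot)) (m≤m+n _ _)
    by-cases (no not-bot) = begin
      degree m                    ≡⟨ sym (m∸n+n≡m (w≤degree m)) ⟩
      degree m ∸ w m + w m        ≤⟨ +-monoʳ-≤ (degree m ∸ w m) w≤inflow ⟩
      degree m ∸ w m + inflow y m ≡⟨ cong (_+ inflow y m) (sym (base-not-bot m∈M not-bot)) ⟩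
      level y m                   ∎
      where
      w≤inflow : w m ≤ inflow y m
      w≤inflow = ≤-trans (w≤sumE m∈M not-bot a∈U)
        (≤-trans (≤-reflexive (sumE≡inflow m∈M not-bot (T-∨₁ {inU m a} a∈U))) (inflow-mono m a⊑y))

  -- Non-firability from 𝔏_m: below l ∈ 𝔏_m, m holds fewer than deg(m)
  -- chips, by the 𝔏-inequalities of Ω.
  L-above⇒level<degree : ∀ {m l y} → T (isM m) → ¬ T (UisBot m) → T (inL m l) → y ⊑ l → level y m < degree m
  L-above⇒level<degree {m} {l} {y} m∈M not-bot l∈L y⊑l = begin-strict
    level y m                   ≡⟨ cong (_+ inflow y m) (base-not-bot m∈M not-bot) ⟩
    degree m ∸ w m + inflow y m ≤⟨ +-monoʳ-≤ (degree m ∸ w m) (inflow-mono m y⊑l) ⟩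
    degree m ∸ w m + inflow l m ≡⟨ cong (degree m ∸ w m +_) (sym (sumE≡inflow m∈M not-bot (T-∨₂ {inU m l} l∈L))) ⟩
    degree m ∸ w m + sumE e m l <⟨ +-monoʳ-< (degree m ∸ w m) (sumE<w m∈M not-bot l∈L) ⟩
    degree m ∸ w m + w m        ≡⟨ m∸n+n≡m (w≤degree m) ⟩
    degree m                    ∎
    where open ≤-Reasoning

  -- A fired vertex had enough chips: if m ∈ M ∖ M_y, the cover of y ∧ m
  -- towards y is labelled m, so some a ∈ 𝔘_m lies below y.
  fired⇒level≥degree : ∀ {y m} → T (fired y m) → degree m ≤ level y m
  fired⇒level≥degree {y} {m} h =
    let m∈M = fired-M {y} h
        y∧m⊏y = ⊑∧⋢⇒⊏ (meet-lb₁ y m) (λ y⊑y∧m → fired-⋢ {y} h (⊑-trans y⊑y∧m (meet-lb₂ y m)))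
        (z , y∧m⋖z , z⊑y) = cover-below y∧m⊏y
        z⋢m = λ z⊑m → ⋖⇒≢ y∧m⋖z (⊑-antisym (⋖⇒⊑ y∧m⋖z) (meet-greatest y m z z⊑y z⊑m))
        (a , a∈U , a⊑y∧m) = U-below (cover⇒starts-label (y∧m⋖z , m∈M , meet-lb₂ y m , z⋢m))
    in U-below⇒level≥degree m∈M a∈U (⊑-trans a⊑y∧m (proj₁ y∧m⊏y))

  -- If the unfired vertex m (y ⊑ m ∈ M) can fire at y, then y has an upper
  -- cover labelled m: otherwise y lies below a member of 𝔏_m.
  firable⇒labelled-cover : ∀ {y m} → T (isM m) → y ⊑ m → degree m ≤ level y m → ∃ λ y' → y ⋖[ m ] y'
  firable⇒labelled-cover {y} {m} m∈M y⊑m firable = case T? (UisBot m) of λ where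
    (yes bot) → U-below⇒labelled-cover (bot∈U bot) (bot-least y) y⊑m
    (no not-bot) → case above-U-or-below-L m y of λ where
      (inj₁ (a , a∈U , a⊑y)) → U-below⇒labelled-cover a∈U a⊑y y⊑m
      (inj₂ (l , l∈L , y⊑l)) → ⊥-elim (≤⇒≯ firable (L-above⇒level<degree m∈M not-bot l∈L y⊑l))

  -- The subtraction in φ is exact: chips plus debt give back the level.
  chips+debt : ∀ y m → φ y (suc m) + debt y m ≡ level y m
  chips+debt y m = exact (fired y m) (fired⇒level≥degree {y})
    where
    exact : ∀ b {k d} → (T b → d ≤ k) → k ∸ when b d + when b d ≡ k
    exact true d≤k = m∸n+n≡m (d≤k tt)
    exact false _ = +-identityʳ _

  unfired-chips : ∀ {y m} → ¬ T (fired y m) → φ y (suc m) ≡ level y m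
  unfired-chips {y} {m} unfired = cong (level y m ∸_) (if-false unfired)

  -- A vertex of M holds fewer than big chips exactly when it has fired, so
  -- φ y records the set M ∖ M_y.
  fired-chips<big : ∀ {y m} → T (fired y m) → φ y (suc m) < big
  fired-chips<big {y} {m} h = begin-strict
    level y m ∸ debt y m                ≡⟨ cong (level y m ∸_) (if-true h) ⟩
    (base m + inflow y m) ∸ degree m    ≤⟨ ∸-monoˡ-≤ (degree m) (+-monoˡ-≤ (inflow y m) (base≤degree m)) ⟩
    (degree m + inflow y m) ∸ degree m  ≡⟨ m+n∸m≡n (degree m) (inflow y m) ⟩
    inflow y m                          ≤⟨ inflow≤total y m ⟩
    totalInflow m                       <⟨ totalInflow<big m ⟩
    big                                 ∎
    where open ≤-Reasoning

  unfired-chips≥big : ∀ {y m} → T (isM m) → ¬ T (fired y m) → big ≤ φ y (suc m)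
  unfired-chips≥big {y} {m} m∈M unfired =
    subst (big ≤_) (sym (unfired-chips {y} unfired)) (≤-trans (big≤base m∈M) (m≤m+n _ _))

  φ-injective : ∀ {y y'} → (∀ m → φ y (suc m) ≡ φ y' (suc m)) → y ≡ y'
  φ-injective {y} {y'} same = ⊑-antisym (M-determines-order (same-M (λ m → sym (same m)))) (M-determines-order (same-M same))
    where
    same-M : ∀ {a b} → (∀ m → φ a (suc m) ≡ φ b (suc m)) → ∀ m → T (isM m) → a ⊑ m → b ⊑ m
    same-M {a} {b} same m m∈M a⊑m = decidable-stable (T? (le b m)) λ b⋢m →
      ≤⇒≯ (subst (big ≤_) (same m) (unfired-chips≥big {a} m∈M (λ h → fired-⋢ {a} h a⊑m))) (fired-chips<big {b} (fired-intro m∈M b⋢m))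

  fired-grows : ∀ {y y' m} → y ⋖[ m ] y' → ∀ (k : Fin n → ℕ) x → when (fired y' x) (k x) ≡ when (fired y x) (k x) + δ m (k m) x
  fired-grows {y} {y'} {m} lab@(y⋖y' , m∈M , y⊑m , y'⋢m) k x with x F.≟ m
  ... | yes refl = trans (if-true (fired-intro m∈M y'⋢m)) (cong (_+ k x) (sym (if-false (λ h → fired-⋢ {y} h y⊑m))))
  ... | no x≢m = trans (cong (λ b → when b (k x)) (sym same)) (sym (+-identityʳ _))
    where
    same : fired y x ≡ fired y' x
    same with T? (isM x) | T? (le y x) | T? (le y' x)
    ... | no x∉M | _ | _ = trans (¬T⇒≡false (λ h → x∉M (fired-M {y} h))) (sym (¬T⇒≡false (λ h → x∉M (fired-M {y'} h))))
    ... | yes x∈M | no y⋢x | _ =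
      trans (T⇒≡true (fired-intro x∈M y⋢x)) (sym (T⇒≡true (fired-intro x∈M (λ y'⊑x → y⋢x (⊑-trans (⋖⇒⊑ y⋖y') y'⊑x)))))
    ... | yes x∈M | yes y⊑x | yes y'⊑x = trans (¬T⇒≡false (λ h → fired-⋢ {y} h y⊑x)) (sym (¬T⇒≡false (λ h → fired-⋢ {y'} h y'⊑x)))
    ... | yes x∈M | yes y⊑x | no y'⋢x = ⊥-elim (x≢m (label-unique y (y⋖y' , x∈M , y⊑x , y'⋢x) lab))

  ∑-fired-grows : ∀ {y y' m} → y ⋖[ m ] y' → ∀ (k : Fin n → ℕ) →
    ∑ (λ x → when (fired y' x) (k x)) ≡ ∑ (λ x → when (fired y x) (k x)) + k m
  ∑-fired-grows {y} {y'} {m} lab k = begin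
    ∑ (λ x → when (fired y' x) (k x))                                ≡⟨ sum-cong-≗ (fired-grows lab k) ⟩
    ∑ (λ x → when (fired y x) (k x) + δ m (k m) x)                   ≡⟨ ∑-distrib-+ (λ x → when (fired y x) (k x)) (δ m (k m)) ⟩
    ∑ (λ x → when (fired y x) (k x)) + ∑ (δ m (k m))                 ≡⟨ cong (∑ (λ x → when (fired y x) (k x)) +_) (∑-δ m (k m)) ⟩
    ∑ (λ x → when (fired y x) (k x)) + k m                           ∎
    where open ≡-Reasoning

  -- At the
  -- sink both sides gain 2·big; at a vertex x, adding debt y x to both sides
  -- reduces the equation to the growth of the fired set and of the inflow.
  firing-step : ∀ {y y' m} → y ⋖[ m ] y' → ∀ u → φ y' u + δ (suc m) (degree m) u ≡ φ y u + graph (suc m) u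
  firing-step {y} {y'} {m} lab zero = trans (+-identityʳ _) (∑-fired-grows lab (λ _ → big + big))
  firing-step {y} {y'} {m} lab (suc x) = +-cancelʳ-≡ (debt y x) _ _ (begin
    φ y' (suc x) + δ (suc m) (degree m) (suc x) + debt y x ≡⟨ cong (λ d → φ y' (suc x) + d + debt y x) (δ-suc m x (degree m)) ⟩
    φ y' (suc x) + δ m (degree m) x + debt y x             ≡⟨ +-assoc (φ y' (suc x)) _ _ ⟩
    φ y' (suc x) + (δ m (degree m) x + debt y x)           ≡⟨ cong (φ y' (suc x) +_) (+-comm _ (debt y x)) ⟩
    φ y' (suc x) + (debt y x + δ m (degree m) x)           ≡⟨ cong (φ y' (suc x) +_) (sym (fired-grows lab degree x)) ⟩
    φ y' (suc x) + debt y' x                               ≡⟨ chips+debt y' x ⟩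
    base x + inflow y' x                                   ≡⟨ cong (base x +_) (∑-fired-grows lab (λ z → edge z x)) ⟩
    base x + (inflow y x + edge m x)                       ≡⟨ sym (+-assoc (base x) _ _) ⟩
    level y x + edge m x                                   ≡⟨ cong (_+ edge m x) (sym (chips+debt y x)) ⟩
    φ y (suc x) + debt y x + edge m x                      ≡⟨ +-assoc (φ y (suc x)) _ _ ⟩
    φ y (suc x) + (debt y x + edge m x)                    ≡⟨ cong (φ y (suc x) +_) (+-comm (debt y x) _) ⟩
    φ y (suc x) + (edge m x + debt y x)                    ≡⟨ sym (+-assoc (φ y (suc x)) _ _) ⟩
    φ y (suc x) + edge m x + debt y x                      ∎)
    where open ≡-Reasoning

  -- Only vertex 0 is a sink: every other vertex sends 2·big > 0 chips to it.
  non-sink : ∀ m → ¬ IsSink (suc m)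
  non-sink m sink = <⇒≢ 0<big (sym (m+n≡0⇒m≡0 big (sink zero (λ ()))))

  labelled⇒firable : ∀ {y y' m} → y ⋖[ m ] y' → degree m ≤ φ y (suc m)
  labelled⇒firable {y} {m = m} lab@(_ , m∈M , y⊑m , _) =
    let (a , a∈U , a⊑y) = U-below (cover⇒starts-label lab)
    in subst (degree m ≤_) (sym (unfired-chips {y} (λ h → fired-⋢ {y} h y⊑m))) (U-below⇒level≥degree m∈M a∈U a⊑y)

  cover⇒fire : ∀ {y y' m} → y ⋖[ m ] y' → Fire (φ y) (φ y')
  cover⇒fire {m = m} lab = suc m , non-sink m , labelled⇒firable lab , firing-step lab

  firable⇒cover : ∀ {y m} → degree m ≤ φ y (suc m) → ∃ λ y' → y ⋖[ m ] y'
  firable⇒cover {y} {m} firable with T? (isM m)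
  ... | no m∉M = ⊥-elim (≤⇒≯ firable (begin-strict
    level y m ∸ debt y m ≤⟨ m∸n≤m (level y m) (debt y m) ⟩
    base m + inflow y m  ≡⟨ cong₂ _+_ (base-non-M m∉M) (inflow-non-M y m∉M) ⟩
    0                    <⟨ <-≤-trans 0<big (big≤degree m) ⟩
    degree m             ∎))
    where open ≤-Reasoning
  ... | yes m∈M with T? (fired y m)
  ...   | yes h = ⊥-elim (≤⇒≯ (≤-trans (big≤degree m) firable) (fired-chips<big {y} h))
  ...   | no unfired = firable⇒labelled-cover m∈M (T-not-not (λ y⋢m → unfired (T-∧-intro {isM m} m∈M y⋢m)))
                         (subst (degree m ≤_) (unfired-chips {y} unfired) firable)

  fire⇒cover : ∀ {y c c'} → (∀ u → c u ≡ φ y u) → Fire c c' → ∃ λ y' → y ⋖ y' × (∀ u → c' u ≡ φ y' u)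
  fire⇒cover c≡φy (zero , not-sink , _) = ⊥-elim (not-sink (λ _ _ → refl))
  fire⇒cover {y} {c} {c'} c≡φy (suc m , _ , firable , fires) =
    let (y' , lab) = firable⇒cover (subst (degree m ≤_) (c≡φy (suc m)) firable)
    in y' , proj₁ lab , λ u → +-cancelʳ-≡ _ _ _
         (trans (fires u) (trans (cong (_+ graph (suc m) u) (c≡φy u)) (sym (firing-step lab u))))

  reach⇒above : ∀ {c₀ c y} → Reach c₀ c → (∀ u → c₀ u ≡ φ y u) → ∃ λ y' → y ⊑ y' × (∀ u → c u ≡ φ y' u)
  reach⇒above ε c₀≡φy = _ , ⊑-refl , c₀≡φy
  reach⇒above (fire ◅ rest) c₀≡φy =
    let (y₁ , y⋖y₁ , c₁≡φy₁) = fire⇒cover c₀≡φy fire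
        (y₂ , y₁⊑y₂ , c≡φy₂) = reach⇒above rest c₁≡φy₁
    in y₂ , ⊑-trans (⋖⇒⊑ y⋖y₁) y₁⊑y₂ , c≡φy₂

  reach⇒⊑ : ∀ {x y} → Reach (φ x) (φ y) → x ⊑ y
  reach⇒⊑ {x} {y} r =
    let (y' , x⊑y' , φy≡φy') = reach⇒above r (λ _ → refl)
    in subst (x ⊑_) (sym (φ-injective (λ m → φy≡φy' (suc m)))) x⊑y'

  ⊑⇒reach : ∀ {x y} → x ⊑ y → Reach (φ x) (φ y)
  ⊑⇒reach {x} {y} = ⊐-induction (λ x → ∀ {y} → x ⊑ y → Reach (φ x) (φ y)) step x
    where
    step : ∀ x → (∀ z → x ⊏ z → ∀ {y} → z ⊑ y → Reach (φ z) (φ y)) → ∀ {y} → x ⊑ y → Reach (φ x) (φ y)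
    step x ih {y} x⊑y = case x F.≟ y of λ where
      (yes x≡y) → subst (λ y → Reach (φ x) (φ y)) x≡y ε
      (no x≢y) →
        let (z , x⋖z , z⊑y) = cover-below (x⊑y , x≢y)
            (_ , lab) = cover-has-label x⋖z
        in cover⇒fire lab ◅ ih z (proj₁ x⋖z) z⊑y

  -- Each firing raises the height of the encoded element, so no firing
  -- sequence from φ 𝟎 is longer than n.
  no-infinite-firing : NoInfiniteFiring (φ bot)
  no-infinite-firing (f , f₀≡φ𝟎 , fires) =
    let (y , _ , n<height) = chain (suc n) in ≤⇒≯ (height≤n y) n<height
    where
    chain : ∀ i → ∃ λ y → (∀ u → f i u ≡ φ y u) × i ≤ height y
    chain zero = bot , f₀≡φ𝟎 , z≤n
    chain (suc i) =
      let (y , fi≡φy , i≤height) = chain i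
          (y' , y⋖y' , fi+1≡φy') = fire⇒cover fi≡φy (fires i)
      in y' , fi+1≡φy' , ≤-<-trans i≤height (height-< (proj₁ y⋖y'))

  generates : Generates (φ bot) L
  generates = no-infinite-firing , φ , (λ x → ⊑⇒reach (bot-least x)) ,
    (λ c r → let (y , _ , c≡φy) = reach⇒above r (λ _ → refl) in y , λ u → sym (c≡φy u)) ,
    (λ x y → ⊑⇒reach , reach⇒⊑)

  -- The game is an ASM: connected through the sink, with the unique sink 0,
  -- and symmetric between non-sink vertices since edge is.
  asm : ASM
  asm = record
    { k = suc n ; E = graph ; O = φ bot
    ; connected = λ u v → to-sink u ◅◅ from-sink v
    ; sink = zero ; sink-isSink = λ _ _ → refl ; sink-unique = sink-unique
    ; symmetric = symmetric }
    where
    Linked : Fin (suc n) → Fin (suc n) → Set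
    Linked a b = (0 < graph a b) ⊎ (0 < graph b a)
    to-sink : ∀ u → Star Linked u zero
    to-sink zero = ε
    to-sink (suc x) = inj₁ (<-≤-trans 0<big (m≤m+n big big)) ◅ ε
    from-sink : ∀ v → Star Linked zero v
    from-sink zero = ε
    from-sink (suc x) = inj₂ (<-≤-trans 0<big (m≤m+n big big)) ◅ ε
    sink-unique : ∀ v → IsSink v → v ≡ zero
    sink-unique zero _ = refl
    sink-unique (suc m) sink = ⊥-elim (non-sink m sink)
    symmetric : ∀ v₁ v₂ → v₁ ≢ v₂ → v₁ ≢ zero → v₂ ≢ zero → graph v₁ v₂ ≡ graph v₂ v₁
    symmetric zero _ _ v₁≢0 _ = ⊥-elim (v₁≢0 refl)
    symmetric (suc _) zero _ _ v₂≢0 = ⊥-elim (v₂≢0 refl)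
    symmetric (suc x) (suc y) _ _ _ = edge-sym x y

mainTheorem12 : (L : FinLattice) →
    LatticeNotions.UpperLocallyDistributive L →
    LatticeNotions.OmegaSolvable L →
    InLASM L
mainTheorem12 L uld Ω-solution = asm , generates
  where open Sandpile L uld Ω-solution
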